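{- Let $\mathcal{F}$ be a finite union-closed family of finite sets. If there exists a subfamily $\mathcal{G}\subseteq\mathcal{F}$ with $|\mathcal{G}|>1$ such that $$\sum_{S\in\mathcal{F}}\log|\mathcal{G}(S)|\leq\frac{|\mathcal{F}|\log|\mathcal{G}|}{2},$$ then there exists an element $i$ such that at least half of the sets in $\mathcal{F}$ contain $i$.
   Context: A family $\mathcal{F}$ of sets is union-closed if $A\cup B\in\mathcal{F}$ for all $A,B\in\mathcal{F}$. All logarithms are base $2$. For a set $S$ and a family $\mathcal{G}$, $\mathcal{G}(S)$ denotes the family $\{S\cup G : G\in\mathcal{G}\}$ (as a set of sets, so $|\mathcal{G}(S)|$ counts distinct sets of this form). -}

module Defs where

open import Data.Nat using (ℕ; _*_; _^_)
open import Data.Bool using (Bool)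
import Data.Bool.Properties as BoolP
open import Data.Fin using (Fin)
open import Data.Fin.Subset using (Subset; _∪_; _∈_)
open import Data.Fin.Subset.Properties using (_∈?_)
open import Data.List using (List; length; map; filter; deduplicate)
open import Data.Nat.ListAction using (product)
open import Data.List.Relation.Unary.Unique.Propositional using (Unique)
import Data.List.Membership.Propositional as LMem
open import Data.Vec.Properties using (≡-dec)
open import Relation.Binary.Definitions using (DecidableEquality)
open import Data.Product using (_×_)

-- Sets are subsets of a finite ground set Fin n (represented as Vec Bool n);
-- a family of sets is a duplicate-free list of subsets.

_≟ˢ_ : ∀ {n} → DecidableEquality (Subset n)
_≟ˢ_ = ≡-dec BoolP._≟_

IsFamily : ∀ {n} → List (Subset n) → Set
IsFamily F = Unique F

UnionClosed : ∀ {n} → List (Subset n) → Set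
UnionClosed F = ∀ A B → A LMem.∈ F → B LMem.∈ F → (A ∪ B) LMem.∈ F

Subfamily : ∀ {n} → List (Subset n) → List (Subset n) → Set
Subfamily G F = IsFamily G × (∀ A → A LMem.∈ G → A LMem.∈ F)

-- 𝒢(S) = { S ∪ G : G ∈ 𝒢 } as a set of sets (duplicates removed).
liftFam : ∀ {n} → Subset n → List (Subset n) → List (Subset n)
liftFam S G = deduplicate _≟ˢ_ (map (S ∪_) G)

card𝒢 : ∀ {n} → List (Subset n) → Subset n → ℕ
card𝒢 G S = length (liftFam S G)

prodCard : ∀ {n} → List (Subset n) → List (Subset n) → ℕ
prodCard F G = product (map (card𝒢 G) F)

degree : ∀ {n} → List (Subset n) → Fin n → ℕ
degree F i = length (filter (i ∈?_) F)

-- Shearer-type bound: if every element of the ground set lies outside at least k members of F, then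
-- |G|^k ≤ ∏_{S ∈ F} |G(S)| for every family G. By induction on the ground set, split G into the slices
-- G₀, G₁ of members without / with the first element. For S = s ∷ S' one has |G(S)| ≥ |G₀(S')| + |G₁(S')|
-- when s is absent and |G(S)| ≥ max (|G₀(S')|, |G₁(S')|) otherwise, and a Hölder inequality (proved over ℕ,
-- without roots, from AM–GM) adds the bounds for G₀ and G₁ over the ≥ k sets avoiding the first element.
-- If no element lies in half of F, take k = |F| − (maximum degree) > |F|/2; then
-- |G|^(2k) ≤ (∏ |G(S)|)² ≤ |G|^|F| contradicts |G| > 1.
module Submission where

open import Defs
import Algebra.Properties.CommutativeSemigroup
open import Data.Bool using (Bool; true; false; not; _∨_)
import Data.Bool.Properties as Bool
open import Data.Empty using (⊥-elim)
open import Data.Fin using (Fin; zero; suc)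
open import Data.Fin.Properties using (any?)
open import Data.Fin.Subset using (Subset; _∪_)
open import Data.Fin.Subset.Properties using (_∈?_)
open import Data.List using (List; []; _∷_; length; map; _++_; replicate; take; drop; tabulate)
open import Data.List.Membership.Propositional using (_∈_)
open import Data.List.Membership.Propositional.Properties using (∈-map⁺; ∈-map⁻; ∈-++⁺ˡ; ∈-++⁺ʳ; ∈-++⁻; ∈-∃++; ∈-deduplicate⁺; ∈-deduplicate⁻)
open import Data.List.Extrema.Nat using (max; xs≤max; argmax-all)
open import Data.List.Properties using (length-map; length-++; length-replicate; length-take; length-drop; take++drop≡id)
open import Data.List.Relation.Binary.Subset.Propositional using (_⊆_)
import Data.List.Relation.Unary.All as All
open import Data.List.Relation.Unary.All using (_∷_)
open import Data.List.Relation.Unary.All.Properties using (¬Any⇒All¬; tabulate⁺; tabulate⁻)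
open import Data.List.Relation.Unary.AllPairs using ([]; _∷_)
open import Data.List.Relation.Unary.Any using (here; there)
open import Data.List.Relation.Unary.Unique.Propositional using (Unique)
import Data.List.Relation.Unary.Unique.Propositional.Properties as Unique
open import Data.List.Relation.Unary.Unique.DecPropositional.Properties using (deduplicate-!)
open import Data.Nat using (ℕ; zero; suc; _+_; _*_; _^_; _∸_; _⊓_; _⊔_; _≤_; _<_; z≤n; s≤s; ≢-nonZero)
open import Data.Nat.ListAction using (sum; product)
open import Data.Nat.ListAction.Properties using (sum-++; product-++)
open import Data.Nat.Properties
open import Data.Nat.Tactic.RingSolver using (solve-∀)
open import Data.Product using (∃; _×_; _,_; proj₁; proj₂)
open import Data.Sum using (inj₁; inj₂)
open import Data.Vec using ([]; _∷_; tail)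
open import Data.Vec.Properties using (∷-injectiveʳ)
open import Function using (_∘_; id)
open import Relation.Binary.PropositionalEquality
open import Relation.Nullary using (¬_; yes; no; does)
open import Relation.Nullary.Decidable using (decidable-stable)

open Algebra.Properties.CommutativeSemigroup *-commutativeSemigroup using (interchange; x∙yz≈y∙xz)

^-distribʳ-* : ∀ m n k → (m * n) ^ k ≡ m ^ k * n ^ k
^-distribʳ-* m n zero = refl
^-distribʳ-* m n (suc k) rewrite ^-distribʳ-* m n k = interchange m n (m ^ k) (n ^ k)

sum-map-*ˡ : ∀ k ns → sum (map (k *_) ns) ≡ k * sum ns
sum-map-*ˡ k [] = sym (*-zeroʳ k)
sum-map-*ˡ k (n ∷ ns) rewrite sum-map-*ˡ k ns = sym (*-distribˡ-+ k n (sum ns))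

product-map-*ˡ : ∀ k ns → product (map (k *_) ns) ≡ k ^ length ns * product ns
product-map-*ˡ k [] = refl
product-map-*ˡ k (n ∷ ns) rewrite product-map-*ˡ k ns = interchange k n (k ^ length ns) (product ns)

sum-replicate : ∀ r n → sum (replicate r n) ≡ r * n
sum-replicate zero n = refl
sum-replicate (suc r) n = cong (n +_) (sum-replicate r n)

product-replicate : ∀ r n → product (replicate r n) ≡ n ^ r
product-replicate zero n = refl
product-replicate (suc r) n = cong (n *_) (product-replicate r n)

product-map-mono : ∀ {A : Set} {f g : A → ℕ} → (∀ x → f x ≤ g x) →
                   ∀ xs → product (map f xs) ≤ product (map g xs)
product-map-mono f≤g [] = ≤-refl
product-map-mono f≤g (x ∷ xs) = *-mono-≤ (f≤g x) (product-map-mono f≤g xs)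

sum≡0⇒product≡0 : ∀ n ns → sum (n ∷ ns) ≡ 0 → product (n ∷ ns) ≡ 0
sum≡0⇒product≡0 n ns eq rewrite m+n≡0⇒m≡0 n eq = refl

n≤2^n : ∀ n → n ≤ 2 ^ n
n≤2^n zero = z≤n
n≤2^n (suc n) = +-mono-≤ (m^n>0 2 n) (subst (n ≤_) (sym (+-identityʳ (2 ^ n))) (n≤2^n n))

m≤n⇒4mn≤[m+n]² : ∀ {m n} → m ≤ n → 4 * (m * n) ≤ (m + n) * (m + n)
m≤n⇒4mn≤[m+n]² {m} m≤n with d , refl ← m≤n⇒∃[o]m+o≡n m≤n =
  ≤-trans (m≤m+n _ (d * d)) (≤-reflexive (expand m d))
  where
  expand : ∀ m d → 4 * (m * (m + d)) + d * d ≡ (m + (m + d)) * (m + (m + d))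
  expand = solve-∀

4mn≤[m+n]² : ∀ m n → 4 * (m * n) ≤ (m + n) * (m + n)
4mn≤[m+n]² m n with ≤-total m n
... | inj₁ m≤n = m≤n⇒4mn≤[m+n]² m≤n
... | inj₂ n≤m = subst₂ (λ p s → 4 * p ≤ s) (*-comm n m) (cong₂ _*_ (+-comm n m) (+-comm n m))
                   (m≤n⇒4mn≤[m+n]² n≤m)

am-gm-doubling : ∀ N p q s t → N ^ N * p ≤ s ^ N → N ^ N * q ≤ t ^ N →
                 (2 * N) ^ (2 * N) * (p * q) ≤ (s + t) ^ (2 * N)
am-gm-doubling N p q s t Np≤s^N Nq≤t^N = begin
  (2 * N) ^ (2 * N) * (p * q)           ≡⟨ cong (_* (p * q)) (sym (^-*-assoc (2 * N) 2 N)) ⟩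
  ((2 * N) ^ 2) ^ N * (p * q)           ≡⟨ cong (λ m → m ^ N * (p * q)) (square-double N) ⟩
  (4 * (N * N)) ^ N * (p * q)           ≡⟨ cong (_* (p * q)) (^-distribʳ-* 4 (N * N) N) ⟩
  4 ^ N * (N * N) ^ N * (p * q)         ≡⟨ cong (λ m → 4 ^ N * m * (p * q)) (^-distribʳ-* N N N) ⟩
  4 ^ N * (N ^ N * N ^ N) * (p * q)     ≡⟨ *-assoc (4 ^ N) _ _ ⟩
  4 ^ N * (N ^ N * N ^ N * (p * q))     ≡⟨ cong (4 ^ N *_) (interchange (N ^ N) (N ^ N) p q) ⟩
  4 ^ N * (N ^ N * p * (N ^ N * q))     ≤⟨ *-monoʳ-≤ (4 ^ N) (*-mono-≤ Np≤s^N Nq≤t^N) ⟩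
  4 ^ N * (s ^ N * t ^ N)               ≡⟨ cong (4 ^ N *_) (sym (^-distribʳ-* s t N)) ⟩
  4 ^ N * (s * t) ^ N                   ≡⟨ sym (^-distribʳ-* 4 (s * t) N) ⟩
  (4 * (s * t)) ^ N                     ≤⟨ ^-monoˡ-≤ N (4mn≤[m+n]² s t) ⟩
  ((s + t) * (s + t)) ^ N               ≡⟨ cong (λ m → ((s + t) * m) ^ N) (sym (*-identityʳ (s + t))) ⟩
  ((s + t) ^ 2) ^ N                     ≡⟨ ^-*-assoc (s + t) 2 N ⟩
  (s + t) ^ (2 * N)                     ∎
  where
  open ≤-Reasoning
  square-double : ∀ x → 2 * x * (2 * x * 1) ≡ 4 * (x * x)
  square-double = solve-∀

am-gm-2^ : ∀ m ns → length ns ≡ 2 ^ m → (2 ^ m) ^ (2 ^ m) * product ns ≤ sum ns ^ (2 ^ m)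
am-gm-2^ zero (n ∷ []) refl = ≤-reflexive (trans (*-identityˡ (n * 1)) (cong (_* 1) (sym (+-identityʳ n))))
am-gm-2^ (suc m) ns |ns|≡2N =
  subst (λ xs → (2 * N) ^ (2 * N) * product xs ≤ sum xs ^ (2 * N)) (take++drop≡id N ns)
    (subst₂ (λ p s → (2 * N) ^ (2 * N) * p ≤ s ^ (2 * N)) (sym (product-++ us vs)) (sym (sum-++ us vs))
      (am-gm-doubling N _ _ _ _ (am-gm-2^ m us |us|≡N) (am-gm-2^ m vs |vs|≡N)))
  where
  N = 2 ^ m
  us = take N ns
  vs = drop N ns
  |us|≡N : length us ≡ N
  |us|≡N = trans (length-take N ns) (trans (cong (N ⊓_) |ns|≡2N) (m≤n⇒m⊓n≡m (m≤m+n N (N + 0))))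
  |vs|≡N : length vs ≡ N
  |vs|≡N = trans (length-drop N ns) (trans (cong (_∸ N) |ns|≡2N) (trans (m+n∸m≡n N (N + 0)) (+-identityʳ N)))

-- Pad k·ns (k = length ns, sum k·s) with 2^k − k copies of s: the mean stays s and the length becomes a power of 2.
am-gm : ∀ ns → length ns ^ length ns * product ns ≤ sum ns ^ length ns
am-gm [] = ≤-refl
am-gm ns@(n ∷ ns′) with sum ns ≟ 0
... | yes s≡0 rewrite sum≡0⇒product≡0 n ns′ s≡0 | *-zeroʳ (length ns ^ length ns) = z≤n
... | no s≢0 =
  *-cancelʳ-≤ (k ^ k * product ns) (s ^ k) (s ^ r) {{m^n≢0 s r {{≢-nonZero s≢0}}}}
    (*-cancelˡ-≤ (N ^ N) {{m^n≢0 N N {{m^n≢0 2 k}}}} (begin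
      N ^ N * (k ^ k * product ns * s ^ r)  ≡⟨ cong (N ^ N *_) (sym product-padded) ⟩
      N ^ N * product padded                ≤⟨ am-gm-2^ k padded length-padded ⟩
      sum padded ^ N                        ≡⟨ cong (_^ N) sum-padded ⟩
      (N * s) ^ N                           ≡⟨ ^-distribʳ-* N s N ⟩
      N ^ N * s ^ N                         ≡⟨ cong (λ e → N ^ N * s ^ e) (sym k+r≡N) ⟩
      N ^ N * s ^ (k + r)                   ≡⟨ cong (N ^ N *_) (^-distribˡ-+-* s k r) ⟩
      N ^ N * (s ^ k * s ^ r)               ∎))
  where
  open ≤-Reasoning
  k = length ns
  s = sum ns
  N = 2 ^ k
  r = N ∸ k
  k+r≡N : k + r ≡ N
  k+r≡N = m+[n∸m]≡n (n≤2^n k)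
  padded = map (k *_) ns ++ replicate r s
  length-padded : length padded ≡ N
  length-padded = trans (length-++ (map (k *_) ns))
    (trans (cong₂ _+_ (length-map (k *_) ns) (length-replicate r)) k+r≡N)
  sum-padded : sum padded ≡ N * s
  sum-padded = trans (sum-++ (map (k *_) ns) (replicate r s))
    (trans (cong₂ _+_ (sum-map-*ˡ k ns) (sum-replicate r s))
      (trans (sym (*-distribʳ-+ s k r)) (cong (_* s) k+r≡N)))
  product-padded : product padded ≡ k ^ k * product ns * s ^ r
  product-padded = trans (product-++ (map (k *_) ns) (replicate r s))
    (cong₂ _*_ (product-map-*ˡ k ns) (product-replicate r s))

dominant-share-bound : ∀ k a b p q c → 0 < p + q → b * p ≤ a * q →
                       (a * (p + q)) ^ k ≤ c * p ^ k → (b * (p + q)) ^ k ≤ c * q ^ k → (a + b) ^ k ≤ c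
dominant-share-bound k a b p@(suc _) q c _ bp≤aq a-bound _ =
  *-cancelʳ-≤ ((a + b) ^ k) c (p ^ k) {{m^n≢0 p k}} (begin
    (a + b) ^ k * p ^ k   ≡⟨ sym (^-distribʳ-* (a + b) p k) ⟩
    ((a + b) * p) ^ k     ≤⟨ ^-monoˡ-≤ k (begin
        (a + b) * p           ≡⟨ *-distribʳ-+ p a b ⟩
        a * p + b * p         ≤⟨ +-monoʳ-≤ (a * p) bp≤aq ⟩
        a * p + a * q         ≡⟨ sym (*-distribˡ-+ a p q) ⟩
        a * (p + q)           ∎) ⟩
    (a * (p + q)) ^ k     ≤⟨ a-bound ⟩
    c * p ^ k             ∎)
  where open ≤-Reasoning
dominant-share-bound zero a b zero q c _ _ _ b-bound = subst (1 ≤_) (*-identityʳ c) b-bound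
dominant-share-bound (suc k) a b zero q@(suc _) c _ _ a-bound b-bound =
  subst (λ a → (a + b) ^ suc k ≤ c) (sym a≡0) (*-cancelʳ-≤ (b ^ suc k) c (q ^ suc k) {{m^n≢0 q (suc k)}}
    (subst (_≤ c * q ^ suc k) (^-distribʳ-* b q (suc k)) b-bound))
  where
  a≡0 : a ≡ 0
  a≡0 = m*n≡0⇒m≡0 a q (m^n≡0⇒m≡0 (a * q) (suc k) (n≤0⇒n≡0 (≤-trans a-bound (≤-reflexive (*-zeroʳ c)))))

-- Read with c = r ^ k: a and b are at most the shares r·p/(p+q) and r·q/(p+q) of r, so a + b ≤ r.
shares-bound : ∀ k a b p q c → 0 < p + q →
               (a * (p + q)) ^ k ≤ c * p ^ k → (b * (p + q)) ^ k ≤ c * q ^ k → (a + b) ^ k ≤ c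
shares-bound k a b p q c p+q>0 a-bound b-bound with ≤-total (b * p) (a * q)
... | inj₁ bp≤aq = dominant-share-bound k a b p q c p+q>0 bp≤aq a-bound b-bound
... | inj₂ aq≤bp = subst (λ m → m ^ k ≤ c) (+-comm b a)
  (dominant-share-bound k b a q p c (subst (0 <_) (+-comm p q) p+q>0) aq≤bp
    (subst (λ m → (b * m) ^ k ≤ c * q ^ k) (+-comm p q) b-bound)
    (subst (λ m → (a * m) ^ k ≤ c * p ^ k) (+-comm p q) a-bound))

total : ℕ × ℕ → ℕ
total (x , y) = x + y

-- share f ps lists f p_j · ∏_{i ≠ j} total p_i, i.e. L · f p_j / total p_j with L = ∏_i total p_i.
share : (ℕ × ℕ → ℕ) → List (ℕ × ℕ) → List ℕ
share f [] = []
share f (p ∷ ps) = f p * product (map total ps) ∷ map (total p *_) (share f ps)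

length-share : ∀ f ps → length (share f ps) ≡ length ps
length-share f [] = refl
length-share f (p ∷ ps) = cong suc (trans (length-map (total p *_) (share f ps)) (length-share f ps))

product-share : ∀ f ps → let L = product (map total ps) in
                product (share f ps) * L ≡ product (map f ps) * L ^ length ps
product-share f [] = refl
product-share f (p ∷ ps) = begin
  f p * L * product (map (t *_) (share f ps)) * (t * L)
    ≡⟨ cong (λ m → f p * L * m * (t * L))
         (trans (product-map-*ˡ t (share f ps)) (cong (λ e → t ^ e * product (share f ps)) (length-share f ps))) ⟩
  f p * L * (t ^ k * product (share f ps)) * (t * L)
    ≡⟨ regroup (f p) L t (t ^ k) (product (share f ps)) ⟩
  f p * t ^ k * t * L * (product (share f ps) * L)
    ≡⟨ cong (f p * t ^ k * t * L *_) (product-share f ps) ⟩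
  f p * t ^ k * t * L * (product (map f ps) * L ^ k)
    ≡⟨ regroup′ (f p) L t (t ^ k) (product (map f ps)) (L ^ k) ⟩
  f p * product (map f ps) * (t * L * (t ^ k * L ^ k))
    ≡⟨ cong (λ m → f p * product (map f ps) * (t * L * m)) (sym (^-distribʳ-* t L k)) ⟩
  f p * product (map f ps) * (t * L * (t * L) ^ k) ∎
  where
  open ≡-Reasoning
  t = total p
  L = product (map total ps)
  k = length ps
  regroup : ∀ x L t tᵏ Z → x * L * (tᵏ * Z) * (t * L) ≡ x * tᵏ * t * L * (Z * L)
  regroup = solve-∀
  regroup′ : ∀ x L t tᵏ X Lᵏ → x * tᵏ * t * L * (X * Lᵏ) ≡ x * X * (t * L * (tᵏ * Lᵏ))
  regroup′ = solve-∀

sum-share : ∀ ps → sum (share proj₁ ps) + sum (share proj₂ ps) ≡ length ps * product (map total ps)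
sum-share [] = refl
sum-share ((x , y) ∷ ps) = begin
  (x * L + sum (map ((x + y) *_) (share proj₁ ps))) + (y * L + sum (map ((x + y) *_) (share proj₂ ps)))
    ≡⟨ cong₂ (λ u v → (x * L + u) + (y * L + v))
         (sum-map-*ˡ (x + y) (share proj₁ ps)) (sum-map-*ˡ (x + y) (share proj₂ ps)) ⟩
  (x * L + (x + y) * sum (share proj₁ ps)) + (y * L + (x + y) * sum (share proj₂ ps))
    ≡⟨ regroup x y L (sum (share proj₁ ps)) (sum (share proj₂ ps)) ⟩
  (x + y) * L + (x + y) * (sum (share proj₁ ps) + sum (share proj₂ ps))
    ≡⟨ cong (λ m → (x + y) * L + (x + y) * m) (sum-share ps) ⟩
  (x + y) * L + (x + y) * (length ps * L)
    ≡⟨ regroup′ x y L (length ps) ⟩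
  suc (length ps) * ((x + y) * L) ∎
  where
  open ≡-Reasoning
  L = product (map total ps)
  regroup : ∀ x y L A B → (x * L + (x + y) * A) + (y * L + (x + y) * B) ≡ (x + y) * L + (x + y) * (A + B)
  regroup = solve-∀
  regroup′ : ∀ x y L k → (x + y) * L + (x + y) * (k * L) ≡ suc k * ((x + y) * L)
  regroup′ = solve-∀

-- A Hölder inequality: with M = 1 it says (∏ x_j)^{1/k} + (∏ y_j)^{1/k} ≤ (∏ (x_j + y_j))^{1/k}.
holder : ∀ ps M a b → let k = length ps in
         a ^ k ≤ M * product (map proj₁ ps) → b ^ k ≤ M * product (map proj₂ ps) →
         (a + b) ^ k ≤ M * product (map total ps)
holder [] M a b a-bound _ = a-bound
holder ps@(_ ∷ _) M a b a-bound b-bound with product (map total ps) ≟ 0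
... | yes L≡0 = subst₂ (λ a b → (a + b) ^ length ps ≤ M * product (map total ps))
                  (sym (vanishes a proj₁ (λ p → m≤m+n (proj₁ p) (proj₂ p)) a-bound))
                  (sym (vanishes b proj₂ (λ p → m≤n+m (proj₂ p) (proj₁ p)) b-bound)) z≤n
  where
  open ≤-Reasoning
  vanishes : ∀ u f → (∀ p → f p ≤ total p) → u ^ length ps ≤ M * product (map f ps) → u ≡ 0
  vanishes u f f≤total u-bound = m^n≡0⇒m≡0 u (length ps) (n≤0⇒n≡0 (≤-trans u-bound (begin
    M * product (map f ps)      ≤⟨ *-monoʳ-≤ M (product-map-mono f≤total ps) ⟩
    M * product (map total ps)  ≡⟨ cong (M *_) L≡0 ⟩
    M * 0                       ≡⟨ *-zeroʳ M ⟩
    0                           ∎)))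
... | no L≢0 = shares-bound k a b P Q (M * L) P+Q>0 (share-bound a proj₁ a-bound) (share-bound b proj₂ b-bound)
  where
  k = length ps
  L = product (map total ps)
  P = sum (share proj₁ ps)
  Q = sum (share proj₂ ps)
  P+Q>0 : 0 < P + Q
  P+Q>0 = subst (0 <_) (sym (sum-share ps)) (*-mono-≤ {1} {k} (s≤s z≤n) (n≢0⇒n>0 L≢0))
  share-bound : ∀ u f → u ^ k ≤ M * product (map f ps) → (u * (P + Q)) ^ k ≤ M * L * sum (share f ps) ^ k
  share-bound u f u-bound = begin
    (u * (P + Q)) ^ k                    ≡⟨ cong (λ m → (u * m) ^ k) (sum-share ps) ⟩
    (u * (k * L)) ^ k                    ≡⟨ trans (^-distribʳ-* u (k * L) k) (cong (u ^ k *_) (^-distribʳ-* k L k)) ⟩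
    u ^ k * (k ^ k * L ^ k)              ≤⟨ *-monoˡ-≤ (k ^ k * L ^ k) u-bound ⟩
    M * X * (k ^ k * L ^ k)              ≡⟨ regroup M X (k ^ k) (L ^ k) ⟩
    M * k ^ k * (X * L ^ k)              ≡⟨ cong (M * k ^ k *_) (sym (product-share f ps)) ⟩
    M * k ^ k * (product (share f ps) * L) ≡⟨ regroup′ M (k ^ k) (product (share f ps)) L ⟩
    M * L * (k ^ k * product (share f ps)) ≤⟨ *-monoʳ-≤ (M * L) am-gm-share ⟩
    M * L * sum (share f ps) ^ k         ∎
    where
    open ≤-Reasoning
    X = product (map f ps)
    am-gm-share : k ^ k * product (share f ps) ≤ sum (share f ps) ^ k
    am-gm-share = subst (λ e → e ^ e * product (share f ps) ≤ sum (share f ps) ^ e)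
                    (length-share f ps) (am-gm (share f ps))
    regroup : ∀ M X kᵏ Lᵏ → M * X * (kᵏ * Lᵏ) ≡ M * kᵏ * (X * Lᵏ)
    regroup = solve-∀
    regroup′ : ∀ M kᵏ Z L → M * kᵏ * (Z * L) ≡ M * L * (kᵏ * Z)
    regroup′ = solve-∀

weight : Bool × ℕ × ℕ → ℕ
weight (true  , x , y) = x + y
weight (false , x , y) = x ⊔ y

left≤weight : ∀ t → proj₁ (proj₂ t) ≤ weight t
left≤weight (true  , x , y) = m≤m+n x y
left≤weight (false , x , y) = m≤m⊔n x y

right≤weight : ∀ t → proj₂ (proj₂ t) ≤ weight t
right≤weight (true  , x , y) = m≤n+m y x
right≤weight (false , x , y) = m≤n⊔m x y

flagged : List (Bool × ℕ × ℕ) → ℕ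
flagged [] = 0
flagged ((true  , _) ∷ ts) = suc (flagged ts)
flagged ((false , _) ∷ ts) = flagged ts

record Selection (ts : List (Bool × ℕ × ℕ)) (k : ℕ) : Set where
  field
    pairs        : List (ℕ × ℕ)
    factor       : ℕ
    length-pairs : length pairs ≡ k
    lefts        : product (map (proj₁ ∘ proj₂) ts) ≤ factor * product (map proj₁ pairs)
    rights       : product (map (proj₂ ∘ proj₂) ts) ≤ factor * product (map proj₂ pairs)
    weights      : factor * product (map total pairs) ≤ product (map weight ts)

select : ∀ ts k → k ≤ flagged ts → Selection ts k
select ts zero _ = record
  { pairs        = []
  ; factor       = product (map weight ts)
  ; length-pairs = refl
  ; lefts        = ≤-trans (product-map-mono left≤weight ts) (≤-reflexive (sym (*-identityʳ _)))
  ; rights       = ≤-trans (product-map-mono right≤weight ts) (≤-reflexive (sym (*-identityʳ _)))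
  ; weights      = ≤-reflexive (*-identityʳ _)
  }
select ((false , x , y) ∷ ts) k@(suc _) k≤flagged = record
  { pairs        = pairs
  ; factor       = (x ⊔ y) * factor
  ; length-pairs = length-pairs
  ; lefts        = ≤-trans (*-mono-≤ (m≤m⊔n x y) lefts) (≤-reflexive (sym (*-assoc (x ⊔ y) factor _)))
  ; rights       = ≤-trans (*-mono-≤ (m≤n⊔m x y) rights) (≤-reflexive (sym (*-assoc (x ⊔ y) factor _)))
  ; weights      = ≤-trans (≤-reflexive (*-assoc (x ⊔ y) factor _)) (*-monoʳ-≤ (x ⊔ y) weights)
  }
  where open Selection (select ts k k≤flagged)
select ((true , x , y) ∷ ts) (suc k) (s≤s k≤flagged) = record
  { pairs        = (x , y) ∷ pairs
  ; factor       = factor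
  ; length-pairs = cong suc length-pairs
  ; lefts        = ≤-trans (*-monoʳ-≤ x lefts) (≤-reflexive (x∙yz≈y∙xz x factor _))
  ; rights       = ≤-trans (*-monoʳ-≤ y rights) (≤-reflexive (x∙yz≈y∙xz y factor _))
  ; weights      = ≤-trans (≤-reflexive (x∙yz≈y∙xz factor (x + y) _)) (*-monoʳ-≤ (x + y) weights)
  }
  where open Selection (select ts k k≤flagged)

holder-flagged : ∀ ts k a b → k ≤ flagged ts →
                 a ^ k ≤ product (map (proj₁ ∘ proj₂) ts) → b ^ k ≤ product (map (proj₂ ∘ proj₂) ts) →
                 (a + b) ^ k ≤ product (map weight ts)
holder-flagged ts k a b k≤flagged a-bound b-bound with select ts k k≤flagged
... | record { pairs = ps ; factor = M ; length-pairs = refl ; lefts = lefts ; rights = rights ; weights = weights } =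
  ≤-trans (holder ps M a b (≤-trans a-bound lefts) (≤-trans b-bound rights)) weights

unique⊆⇒length≤ : ∀ {A : Set} {xs ys : List A} → Unique xs → xs ⊆ ys → length xs ≤ length ys
unique⊆⇒length≤ {xs = []} _ _ = z≤n
unique⊆⇒length≤ {xs = x ∷ xs} (x∉xs ∷ unique-xs) x∷xs⊆ys
  with ys₁ , ys₂ , refl ← ∈-∃++ (x∷xs⊆ys (here refl)) =
  ≤-trans (s≤s (unique⊆⇒length≤ unique-xs xs⊆ys₁++ys₂)) (≤-reflexive (begin
    suc (length (ys₁ ++ ys₂))        ≡⟨ cong suc (length-++ ys₁) ⟩
    suc (length ys₁ + length ys₂)    ≡⟨ sym (+-suc (length ys₁) (length ys₂)) ⟩
    length ys₁ + length (x ∷ ys₂)    ≡⟨ sym (length-++ ys₁) ⟩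
    length (ys₁ ++ x ∷ ys₂)          ∎))
  where
  open ≡-Reasoning
  xs⊆ys₁++ys₂ : xs ⊆ ys₁ ++ ys₂
  xs⊆ys₁++ys₂ z∈xs with ∈-++⁻ ys₁ (x∷xs⊆ys (there z∈xs))
  ... | inj₁ z∈ys₁         = ∈-++⁺ˡ z∈ys₁
  ... | inj₂ (here z≡x)    = ⊥-elim (All.lookup x∉xs z∈xs (sym z≡x))
  ... | inj₂ (there z∈ys₂) = ∈-++⁺ʳ ys₁ z∈ys₂

cons-unique : ∀ {n} b {xs : List (Subset n)} → Unique xs → Unique (map (b ∷_) xs)
cons-unique b = Unique.map⁺ ∷-injectiveʳ

slice : ∀ {n} → Bool → List (Subset (suc n)) → List (Subset n)
slice b [] = []
slice b ((c ∷ A) ∷ G) with b Bool.≟ c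
... | yes _ = A ∷ slice b G
... | no  _ = slice b G

slice-⊆ : ∀ {n} b (G : List (Subset (suc n))) {A} → A ∈ slice b G → (b ∷ A) ∈ G
slice-⊆ b ((c ∷ A) ∷ G) A∈ with b Bool.≟ c
slice-⊆ b ((b ∷ A) ∷ G) (here refl) | yes refl = here refl
slice-⊆ b ((b ∷ A) ∷ G) (there A∈)  | yes refl = there (slice-⊆ b G A∈)
... | no _ = there (slice-⊆ b G A∈)

slice-unique : ∀ {n} b (G : List (Subset (suc n))) → Unique G → Unique (slice b G)
slice-unique b [] [] = []
slice-unique b ((c ∷ A) ∷ G) (cA∉G ∷ unique-G) with b Bool.≟ c
... | yes refl = ¬Any⇒All¬ (slice b G) (λ A∈ → All.lookup cA∉G (slice-⊆ b G A∈) refl)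
                 ∷ slice-unique b G unique-G
... | no _     = slice-unique b G unique-G

length-slices : ∀ {n} (G : List (Subset (suc n))) → length G ≡ length (slice false G) + length (slice true G)
length-slices [] = refl
length-slices ((false ∷ A) ∷ G) = cong suc (length-slices G)
length-slices ((true ∷ A) ∷ G) = trans (cong suc (length-slices G)) (sym (+-suc _ _))

∪-∈-liftFam : ∀ {n} (S : Subset n) {A G} → A ∈ G → S ∪ A ∈ liftFam S G
∪-∈-liftFam S A∈G = ∈-deduplicate⁺ _≟ˢ_ (∈-map⁺ (S ∪_) A∈G)

∈-liftFam⁻ : ∀ {n} (S : Subset n) G {T} → T ∈ liftFam S G → ∃ λ A → A ∈ G × T ≡ S ∪ A
∈-liftFam⁻ S G T∈ = ∈-map⁻ (S ∪_) (∈-deduplicate⁻ _≟ˢ_ (map (S ∪_) G) T∈)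

liftFam-unique : ∀ {n} (S : Subset n) G → Unique (liftFam S G)
liftFam-unique S G = deduplicate-! _≟ˢ_ (map (S ∪_) G)

cons-liftFam-slice-⊆ : ∀ {n} c b (S : Subset n) G →
                       map ((c ∨ b) ∷_) (liftFam S (slice b G)) ⊆ liftFam (c ∷ S) G
cons-liftFam-slice-⊆ c b S G T∈ with ∈-map⁻ ((c ∨ b) ∷_) T∈
... | T , T∈′ , refl with ∈-liftFam⁻ S (slice b G) T∈′
...   | A , A∈ , refl = ∪-∈-liftFam (c ∷ S) (slice-⊆ b G A∈)

card-slice≤card-true : ∀ {n} b (S : Subset n) G → card𝒢 (slice b G) S ≤ card𝒢 G (true ∷ S)
card-slice≤card-true b S G = subst (_≤ card𝒢 G (true ∷ S)) (length-map (true ∷_) (liftFam S (slice b G)))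
  (unique⊆⇒length≤ (cons-unique true (liftFam-unique S (slice b G))) (cons-liftFam-slice-⊆ true b S G))

card-slices≤card-false : ∀ {n} (S : Subset n) G →
                         card𝒢 (slice false G) S + card𝒢 (slice true G) S ≤ card𝒢 G (false ∷ S)
card-slices≤card-false S G = subst (_≤ card𝒢 G (false ∷ S)) length-both
  (unique⊆⇒length≤ (Unique.++⁺ (lifted-unique false) (lifted-unique true) disjoint) both⊆)
  where
  lifted : Bool → List (Subset (suc _))
  lifted b = map (b ∷_) (liftFam S (slice b G))
  lifted-unique : ∀ b → Unique (lifted b)
  lifted-unique b = cons-unique b (liftFam-unique S (slice b G))
  length-both : length (lifted false ++ lifted true) ≡ card𝒢 (slice false G) S + card𝒢 (slice true G) S
  length-both = trans (length-++ (lifted false))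
    (cong₂ _+_ (length-map (false ∷_) (liftFam S (slice false G))) (length-map (true ∷_) (liftFam S (slice true G))))
  disjoint : ∀ {T} → ¬ (T ∈ lifted false × T ∈ lifted true)
  disjoint (T∈₀ , T∈₁) with ∈-map⁻ (false ∷_) T∈₀ | ∈-map⁻ (true ∷_) T∈₁
  ... | _ , _ , refl | _ , _ , ()
  both⊆ : lifted false ++ lifted true ⊆ liftFam (false ∷ S) G
  both⊆ T∈ with ∈-++⁻ (lifted false) T∈
  ... | inj₁ T∈₀ = cons-liftFam-slice-⊆ false false S G T∈₀
  ... | inj₂ T∈₁ = cons-liftFam-slice-⊆ false true S G T∈₁

degree-suc : ∀ {n} (F : List (Subset (suc n))) i → degree F (suc i) ≡ degree (map tail F) i
degree-suc [] i = refl
degree-suc ((s ∷ S) ∷ F) i with does (i ∈? S)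
... | true  = cong suc (degree-suc F i)
... | false = degree-suc F i

sliceCards : ∀ {n} → List (Subset (suc n)) → Subset (suc n) → Bool × ℕ × ℕ
sliceCards G (s ∷ S) = not s , card𝒢 (slice false G) S , card𝒢 (slice true G) S

product-lefts : ∀ {n} (G : List (Subset (suc n))) F →
                product (map (proj₁ ∘ proj₂) (map (sliceCards G) F)) ≡ prodCard (map tail F) (slice false G)
product-lefts G [] = refl
product-lefts G ((s ∷ S) ∷ F) = cong (card𝒢 (slice false G) S *_) (product-lefts G F)

product-rights : ∀ {n} (G : List (Subset (suc n))) F →
                 product (map (proj₂ ∘ proj₂) (map (sliceCards G) F)) ≡ prodCard (map tail F) (slice true G)
product-rights G [] = refl
product-rights G ((s ∷ S) ∷ F) = cong (card𝒢 (slice true G) S *_) (product-rights G F)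

product-weights≤prodCard : ∀ {n} (G : List (Subset (suc n))) F →
                           product (map weight (map (sliceCards G) F)) ≤ prodCard F G
product-weights≤prodCard G [] = ≤-refl
product-weights≤prodCard G ((false ∷ S) ∷ F) =
  *-mono-≤ (card-slices≤card-false S G) (product-weights≤prodCard G F)
product-weights≤prodCard G ((true ∷ S) ∷ F) =
  *-mono-≤ (⊔-lub (card-slice≤card-true false S G) (card-slice≤card-true true S G)) (product-weights≤prodCard G F)

degree-zero+flagged : ∀ {n} (G : List (Subset (suc n))) F →
                      degree F zero + flagged (map (sliceCards G) F) ≡ length F
degree-zero+flagged G [] = refl
degree-zero+flagged G ((true ∷ S) ∷ F) = cong suc (degree-zero+flagged G F)
degree-zero+flagged G ((false ∷ S) ∷ F) = trans (+-suc (degree F zero) _) (cong suc (degree-zero+flagged G F))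

prodCard-point : (F : List (Subset 0)) → prodCard F ([] ∷ []) ≡ 1
prodCard-point [] = refl
prodCard-point (S ∷ F) = trans (+-identityʳ _) (prodCard-point F)

shearer : ∀ {n} (G : List (Subset n)) → Unique G → ∀ F k → 0 < k →
          (∀ i → degree F i + k ≤ length F) → length G ^ k ≤ prodCard F G
shearer {zero} [] _ F (suc k) _ _ = z≤n
shearer {zero} ([] ∷ []) _ F k _ _ = ≤-reflexive (trans (^-zeroˡ k) (sym (prodCard-point F)))
shearer {zero} ([] ∷ [] ∷ _) (([]≢[] ∷ _) ∷ _) _ _ _ _ = ⊥-elim ([]≢[] refl)
shearer {suc n} G unique-G F k k>0 codegree = begin
  length G ^ k                                          ≡⟨ cong (_^ k) (length-slices G) ⟩
  (length (slice false G) + length (slice true G)) ^ k  ≤⟨ holder-flagged columns k _ _ enough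
                                                             (subst (_ ≤_) (sym (product-lefts G F)) (on-slice false))
                                                             (subst (_ ≤_) (sym (product-rights G F)) (on-slice true)) ⟩
  product (map weight columns)                          ≤⟨ product-weights≤prodCard G F ⟩
  prodCard F G                                          ∎
  where
  open ≤-Reasoning
  columns = map (sliceCards G) F
  codegree-tails : ∀ i → degree (map tail F) i + k ≤ length (map tail F)
  codegree-tails i = subst₂ (λ d l → d + k ≤ l) (degree-suc F i) (sym (length-map tail F)) (codegree (suc i))
  on-slice : ∀ b → length (slice b G) ^ k ≤ prodCard (map tail F) (slice b G)
  on-slice b = shearer (slice b G) (slice-unique b G unique-G) (map tail F) k k>0 codegree-tails
  enough : k ≤ flagged columns
  enough = +-cancelˡ-≤ (degree F zero) k _
             (subst (degree F zero + k ≤_) (sym (degree-zero+flagged G F)) (codegree zero))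

no-popular⇒codegree : ∀ {n} (F : List (Subset n)) → 0 < length F → ¬ (∃ λ i → length F ≤ 2 * degree F i) →
                      ∃ λ k → 0 < k × length F < k + k × (∀ i → degree F i + k ≤ length F)
no-popular⇒codegree F |F|>0 no-popular =
  k , ≤-<-trans z≤n d<k , |F|<k+k , λ i → ≤-trans (+-monoˡ-≤ k (degree≤d i)) (≤-reflexive d+k≡|F|)
  where
  degrees = tabulate (degree F)
  d = max 0 degrees
  k = length F ∸ d
  2d<|F| : 2 * d < length F
  2d<|F| = argmax-all id {P = λ v → 2 * v < length F} |F|>0 (tabulate⁺ (λ i → ≰⇒> (no-popular ∘ (i ,_))))
  degree≤d : ∀ i → degree F i ≤ d
  degree≤d = tabulate⁻ (xs≤max 0 degrees)
  d+k≡|F| : d + k ≡ length F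
  d+k≡|F| = m+[n∸m]≡n (≤-trans (m≤m+n d (d + 0)) (<⇒≤ 2d<|F|))
  d<k : d < k
  d<k = +-cancelˡ-< d d k (subst₂ _<_ (cong (d +_) (+-identityʳ d)) (sym d+k≡|F|) 2d<|F|)
  |F|<k+k : length F < k + k
  |F|<k+k = subst (_< k + k) d+k≡|F| (+-monoˡ-< k d<k)

corollary4p1 : (n : ℕ) (F : List (Subset n)) → IsFamily F → UnionClosed F →
    (∃ λ (G : List (Subset n)) → Subfamily G F × 1 < length G ×
        prodCard F G * prodCard F G ≤ length G ^ length F) →
    ∃ λ (i : Fin n) → length F ≤ 2 * degree F i
corollary4p1 n F _ _ (G , (unique-G , G⊆F) , 1<|G| , hyp) =
  decidable-stable (any? (λ i → length F ≤? 2 * degree F i)) λ no-popular →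
    let k , k>0 , |F|<k+k , codegree = no-popular⇒codegree F |F|>0 no-popular
        bound = shearer G unique-G F k k>0 codegree
    in <⇒≱ (^-monoʳ-< (length G) 1<|G| |F|<k+k) (begin
      length G ^ (k + k)           ≡⟨ ^-distribˡ-+-* (length G) k k ⟩
      length G ^ k * length G ^ k  ≤⟨ *-mono-≤ bound bound ⟩
      prodCard F G * prodCard F G  ≤⟨ hyp ⟩
      length G ^ length F          ∎)
  where
  open ≤-Reasoning
  |F|>0 : 0 < length F
  |F|>0 = ≤-trans (<⇒≤ 1<|G|) (unique⊆⇒length≤ unique-G (G⊆F _))
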